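{- $\mathbb{F}$-augmented generalized closure spaces as objects, with approximable mappings as morphisms, form a category, where the composite of $\Theta:(X,\tau\circ\gamma,\mathcal{F})\to(X',\tau'\circ\gamma',\mathcal{F}')$ and $\Theta':(X',\tau'\circ\gamma',\mathcal{F}')\to(X'',\tau''\circ\gamma'',\mathcal{F}'')$ is the relation $\Theta\circ\Theta'\subseteq\mathcal{F}\times X''$ given by $F(\Theta\circ\Theta')x''\iff\exists G\in\mathcal{F}'\,(F\Theta G\text{ and }G\Theta'x'')$, and the identity on $(X,\tau\circ\gamma,\mathcal{F})$ is $\mathrm{id}_X=\{(F,x)\in\mathcal{F}\times X: x\in\langle F\rangle\}$. (That is: composites and identities are approximable mappings, composition is associative, and the identities are neutral.)
   Context: A closure operator on $X$ is a map $\gamma:\mathcal{P}(X)\to\mathcal{P}(X)$ that is extensive, idempotent and monotone. A generalized closure space is a pair $(X,\tau\circ\gamma)$ where $\gamma$ is a closure operator and $\tau:\mathcal{P}(X)\to\mathcal{P}(X)$ satisfies for all $A,B\subseteq X$: $\tau(\gamma(A))\subseteq\gamma(A)$; $\tau(\tau(\gamma(A)))=\tau(\gamma(A))$; $A\subseteq B\Rightarrow\tau(\gamma(A))\subseteq\tau(\gamma(B))$. Write $\langle A\rangle=\tau(\gamma(A))$ (primed versions for other spaces). An $\mathbb{F}$-augmented generalized closure space is a triple $(X,\tau\circ\gamma,\mathcal{F})$ with $(X,\tau\circ\gamma)$ a generalized closure space and $\mathcal{F}$ a nonempty family of finite subsets of $X$ such that for every $F\in\mathcal{F}$ and finite $M\subseteq\langle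 F\rangle$ there is $F_1\in\mathcal{F}$ with $M\subseteq\langle F_1\rangle$ and $F_1\subseteq\langle F\rangle$. An approximable mapping from $(X,\tau\circ\gamma,\mathcal{F})$ to $(X',\tau'\circ\gamma',\mathcal{F}')$ is a relation $\Theta\subseteq\mathcal{F}\times X'$ (for $F\in\mathcal{F}$, $S\subseteq X'$ write $F\Theta S$ if $F\Theta x'$ for all $x'\in S$) such that for all $F,F_1\in\mathcal{F}$, $F'\in\mathcal{F}'$, finite $M'\subseteq X'$: (AM1) $F\Theta F'\Rightarrow F\Theta\langle F'\rangle'$; (AM2) $F\subseteq\langle F_1\rangle$ and $F\Theta M'$ imply $F_1\Theta M'$; (AM3) $F\Theta M'$ implies there are $G\in\mathcal{F}$, $G'\in\mathcal{F}'$ with $G\subseteq\langle F\rangle$, $M'\subseteq\langle G'\rangle'$ and $G\Theta G'$. -}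

module Defs where

open import Level using (0ℓ)
open import Data.List using (List)
open import Data.List.Membership.Propositional using (_∈_)
open import Data.Product using (Σ; ∃; _×_; _,_)
open import Relation.Unary using (Pred; _⊆_; _≐_)

Subset : Set → Set₁
Subset X = Pred X 0ℓ

-- Finite subsets are represented by lists (up to having the same elements).
⟦_⟧ : {X : Set} → List X → Subset X
⟦ F ⟧ = λ x → x ∈ F

_≈ₛ_ : {X : Set} → List X → List X → Set
F ≈ₛ G = ⟦ F ⟧ ≐ ⟦ G ⟧

record ClosureOperator (X : Set) : Set₁ where
  field
    γ          : Subset X → Subset X
    extensive  : ∀ (A : Subset X) → A ⊆ γ A
    idempotent : ∀ (A : Subset X) → γ (γ A) ≐ γ A
    monotone   : ∀ {A B : Subset X} → A ⊆ B → γ A ⊆ γ B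

record GenClosureSpace (X : Set) : Set₁ where
  field
    closure : ClosureOperator X
    τ       : Subset X → Subset X
    -- τ is a function on *sets*: it respects extensional equality of predicates
    -- (automatic in set theory, where extensionally equal subsets are equal)
    τ-resp  : ∀ {A B : Subset X} → A ≐ B → τ A ≐ τ B
  open ClosureOperator closure public
  field
    τγ-sub  : ∀ (A : Subset X) → τ (γ A) ⊆ γ A
    τγ-idem : ∀ (A : Subset X) → τ (τ (γ A)) ≐ τ (γ A)
    τγ-mono : ∀ {A B : Subset X} → A ⊆ B → τ (γ A) ⊆ τ (γ B)

  ⟨_⟩ : Subset X → Subset X
  ⟨ A ⟩ = τ (γ A)

record FAugGCS : Set₁ where
  field
    Carrier : Set
    space   : GenClosureSpace Carrier
  open GenClosureSpace space public
  field
    𝓕        : Pred (List Carrier) 0ℓ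
    𝓕-resp   : ∀ {F G : List Carrier} → F ≈ₛ G → 𝓕 F → 𝓕 G
    nonempty : ∃ λ F → 𝓕 F
    augment  : ∀ (F : List Carrier) → 𝓕 F → (M : List Carrier) → ⟦ M ⟧ ⊆ ⟨ ⟦ F ⟧ ⟩ →
               ∃ λ F₁ → 𝓕 F₁ × ⟦ M ⟧ ⊆ ⟨ ⟦ F₁ ⟧ ⟩ × ⟦ F₁ ⟧ ⊆ ⟨ ⟦ F ⟧ ⟩

open FAugGCS

FRel : FAugGCS → FAugGCS → Set₁
FRel A B = List (Carrier A) → Carrier B → Set

record IsApproximable (A B : FAugGCS) (Θ : FRel A B) : Set₁ where
  field
    dom-𝓕 : ∀ {F x} → Θ F x → 𝓕 A F
    -- Θ is a relation on finite *sets* (independent of list representation)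
    resp  : ∀ {F F₁ x} → F ≈ₛ F₁ → Θ F x → Θ F₁ x
    AM1   : ∀ {F F'} → 𝓕 A F → 𝓕 B F' → ⟦ F' ⟧ ⊆ Θ F → ⟨_⟩ B ⟦ F' ⟧ ⊆ Θ F
    AM2   : ∀ {F F₁ M'} → 𝓕 A F → 𝓕 A F₁ → ⟦ F ⟧ ⊆ ⟨_⟩ A ⟦ F₁ ⟧ → ⟦ M' ⟧ ⊆ Θ F → ⟦ M' ⟧ ⊆ Θ F₁
    AM3   : ∀ {F M'} → 𝓕 A F → ⟦ M' ⟧ ⊆ Θ F →
            ∃ λ G → ∃ λ G' → 𝓕 A G × 𝓕 B G' × ⟦ G ⟧ ⊆ ⟨_⟩ A ⟦ F ⟧ ×
              ⟦ M' ⟧ ⊆ ⟨_⟩ B ⟦ G' ⟧ × ⟦ G' ⟧ ⊆ Θ G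

compose : (A B C : FAugGCS) → FRel A B → FRel B C → FRel A C
compose A B C Θ Θ' F x = 𝓕 A F × ∃ λ G → 𝓕 B G × ⟦ G ⟧ ⊆ Θ F × Θ' G x

identity : (A : FAugGCS) → FRel A A
identity A F x = 𝓕 A F × ⟨_⟩ A ⟦ F ⟧ x

_≃_ : {A B : FAugGCS} → FRel A B → FRel A B → Set
_≃_ {A} {B} R S = ∀ (F : List (Carrier A)) (x : Carrier B) → (R F x → S F x) × (S F x → R F x)

module Submission where

-- Factorization yields (AM1) and (AM3) for composites and the nontrivial half
-- of associativity; the unit laws follow from AM1–AM3 for Θ alone.

open import Defs
open import Data.Product using (_×_; _,_; proj₁; proj₂; ∃)
open import Data.List using (List; []; _∷_; _++_)
open import Data.List.Relation.Unary.Any using (here; there)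
open import Data.List.Membership.Propositional.Properties using (∈-++⁺ˡ; ∈-++⁺ʳ; ∈-++⁻)
open import Data.Sum using ([_,_])
open import Relation.Binary.PropositionalEquality using (refl)
open import Relation.Unary using (_⊆_)
open FAugGCS
open IsApproximable

singleton-⊆ : {X : Set} {P : Subset X} {x : X} → P x → ⟦ x ∷ [] ⟧ ⊆ P
singleton-⊆ px (here refl) = px

++-⊆ : {X : Set} {P : Subset X} (G₁ : List X) {G₂ : List X} →
       ⟦ G₁ ⟧ ⊆ P → ⟦ G₂ ⟧ ⊆ P → ⟦ G₁ ++ G₂ ⟧ ⊆ P
++-⊆ G₁ s₁ s₂ p = [ s₁ , s₂ ] (∈-++⁻ G₁ p)

-- Transitivity of the generalized closure: ⟨⟨S⟩⟩ = ⟨S⟩ up to inclusion, so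
-- anything generated by a subset of ⟨S⟩ already lies in ⟨S⟩.
⟨_⟩-trans : (A : FAugGCS) {S T : Subset (Carrier A)} → T ⊆ ⟨_⟩ A S → ⟨_⟩ A T ⊆ ⟨_⟩ A S
⟨_⟩-trans A {S} T⊆⟨S⟩ x∈⟨T⟩ =
  proj₁ (τ-resp A (idempotent A S)) (τγ-mono A (τγ-sub A S) (τγ-mono A T⊆⟨S⟩ x∈⟨T⟩))

module Approximable {A B : FAugGCS} {Θ : FRel A B} (Θ-approx : IsApproximable A B Θ) where

  transport : ∀ {F F₁ y} → 𝓕 A F → 𝓕 A F₁ → ⟦ F ⟧ ⊆ ⟨_⟩ A ⟦ F₁ ⟧ → Θ F y → Θ F₁ y
  transport fF fF₁ F⊆⟨F₁⟩ Fy =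
    AM2 Θ-approx fF fF₁ F⊆⟨F₁⟩ (singleton-⊆ Fy) (here refl)

  -- Witness form of (AM3): if F Θ M, then M is generated by some G' ∈ 𝓕'
  -- with F Θ G' (the G produced by AM3 is moved back to F by AM2).
  witness : ∀ {F} (M : List (Carrier B)) → 𝓕 A F → ⟦ M ⟧ ⊆ Θ F →
            ∃ λ G' → 𝓕 B G' × ⟦ G' ⟧ ⊆ Θ F × ⟦ M ⟧ ⊆ ⟨_⟩ B ⟦ G' ⟧
  witness M fF FM with AM3 Θ-approx {M' = M} fF FM
  ... | G , G' , fG , fG' , G⊆⟨F⟩ , M⊆⟨G'⟩ , GG' =
    G' , fG' , AM2 Θ-approx fG fF G⊆⟨F⟩ GG' , M⊆⟨G'⟩

  -- Interpolation in the domain: F Θ y is already witnessed by some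
  -- K ∈ 𝓕 with K ⊆ ⟨F⟩ (AM3 followed by AM1).
  interpolate : ∀ {F y} → Θ F y → ∃ λ K → 𝓕 A K × ⟦ K ⟧ ⊆ ⟨_⟩ A ⟦ F ⟧ × Θ K y
  interpolate Fy with AM3 Θ-approx (dom-𝓕 Θ-approx Fy) (singleton-⊆ Fy)
  ... | K , K' , fK , fK' , K⊆⟨F⟩ , y∈⟨K'⟩ , KK' =
    K , fK , K⊆⟨F⟩ , AM1 Θ-approx fK fK' KK' (y∈⟨K'⟩ (here refl))

module Composite (A B C : FAugGCS) {Θ : FRel A B} {Θ' : FRel B C}
                 (Θ-approx : IsApproximable A B Θ) (Θ'-approx : IsApproximable B C Θ') where

  open Approximable Θ-approx using (witness)
  open Approximable Θ'-approx using (transport)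

  _Θ∘Θ'_ : FRel A C
  _Θ∘Θ'_ = compose A B C Θ Θ'

  factor : ∀ {F} (L : List (Carrier C)) → 𝓕 A F → ⟦ L ⟧ ⊆ _Θ∘Θ'_ F →
           ∃ λ G' → 𝓕 B G' × ⟦ G' ⟧ ⊆ Θ F × ⟦ L ⟧ ⊆ Θ' G'
  factor [] fF _ with witness [] fF (λ ())
  ... | G' , fG' , FG' , _ = G' , fG' , FG' , λ ()
  factor (y ∷ L) fF FL with FL (here refl) | factor L fF (λ p → FL (there p))
  ... | _ , Gy , fGy , FGy , Gy-y | GL , fGL , FGL , GL-L
    with witness (Gy ++ GL) fF (++-⊆ Gy FGy FGL)
  ... | G' , fG' , FG' , Gs⊆⟨G'⟩ = G' , fG' , FG' , λ
    { (here refl) → transport fGy fG' (λ p → Gs⊆⟨G'⟩ (∈-++⁺ˡ p)) Gy-y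
    ; (there p)   → transport fGL fG' (λ q → Gs⊆⟨G'⟩ (∈-++⁺ʳ Gy q)) (GL-L p) }

  -- The composite is approximable.  AM1 and AM3 reduce to the corresponding
  -- axioms for Θ' after factoring; AM3 then pulls the result back through Θ.
  composite-approximable : IsApproximable A C _Θ∘Θ'_
  composite-approximable .dom-𝓕 (fF , _) = fF
  composite-approximable .resp F≈F₁ (fF , G , fG , FG , GΘ'x) =
    𝓕-resp A F≈F₁ fF , G , fG , (λ p → resp Θ-approx F≈F₁ (FG p)) , GΘ'x
  composite-approximable .AM1 {F} {F''} fF fF'' FF'' with factor F'' fF FF''
  ... | G' , fG' , FG' , G'F'' = λ x∈⟨F''⟩ →
    fF , G' , fG' , FG' , AM1 Θ'-approx fG' fF'' G'F'' x∈⟨F''⟩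
  composite-approximable .AM2 fF fF₁ F⊆⟨F₁⟩ FM p with FM p
  ... | _ , G , fG , FG , GΘ'x = fF₁ , G , fG , AM2 Θ-approx fF fF₁ F⊆⟨F₁⟩ FG , GΘ'x
  composite-approximable .AM3 {F} {M} fF FM with factor M fF FM
  ... | G' , fG' , FG' , G'M with AM3 Θ'-approx fG' G'M
  ... | H , H'' , fH , fH'' , H⊆⟨G'⟩ , M⊆⟨H''⟩ , HH''
    with AM3 Θ-approx {M' = H} fF (λ p → AM1 Θ-approx fF fG' FG' (H⊆⟨G'⟩ p))
  ... | K , K' , fK , fK' , K⊆⟨F⟩ , H⊆⟨K'⟩ , KK' =
    K , H'' , fK , fH'' , K⊆⟨F⟩ , M⊆⟨H''⟩ ,
    λ p → fK , K' , fK' , KK' , transport fH fK' H⊆⟨K'⟩ (HH'' p)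

-- The identity relation id_X is approximable: AM1/AM2 are transitivity of
-- ⟨_⟩, and AM3 is two applications of the augmentation axiom.
identity-approximable : (A : FAugGCS) → IsApproximable A A (identity A)
identity-approximable A .dom-𝓕 (fF , _) = fF
identity-approximable A .resp F≈F₁ (fF , x∈⟨F⟩) =
  𝓕-resp A F≈F₁ fF , τγ-mono A (proj₁ F≈F₁) x∈⟨F⟩
identity-approximable A .AM1 fF fF' F' x∈⟨F'⟩ = fF , ⟨ A ⟩-trans (λ p → proj₂ (F' p)) x∈⟨F'⟩
identity-approximable A .AM2 fF fF₁ F⊆⟨F₁⟩ FM p = fF₁ , ⟨ A ⟩-trans F⊆⟨F₁⟩ (proj₂ (FM p))
identity-approximable A .AM3 {F} {M} fF FM with augment A F fF M (λ p → proj₂ (FM p))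
... | F₁ , fF₁ , M⊆⟨F₁⟩ , F₁⊆⟨F⟩ with augment A F fF F₁ F₁⊆⟨F⟩
... | F₂ , fF₂ , F₁⊆⟨F₂⟩ , F₂⊆⟨F⟩ =
  F₂ , F₁ , fF₂ , fF₁ , F₂⊆⟨F⟩ , M⊆⟨F₁⟩ , λ p → fF₂ , F₁⊆⟨F₂⟩ p

-- Associativity.  From (Θ ∘ Θ') ∘ Θ'' to Θ ∘ (Θ' ∘ Θ'') we factor the middle
-- set through one G' ∈ 𝓕'; the converse direction is a regrouping.
composition-assoc : ∀ (A B C D : FAugGCS) (Θ : FRel A B) (Θ' : FRel B C) (Θ'' : FRel C D) →
  IsApproximable A B Θ → IsApproximable B C Θ' → IsApproximable C D Θ'' →
  _≃_ {A} {D} (compose A C D (compose A B C Θ Θ') Θ'') (compose A B D Θ (compose B C D Θ' Θ''))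
composition-assoc A B C D Θ Θ' Θ'' Θ-approx Θ'-approx _ F x = regroup-right , regroup-left
  where
  open Composite A B C Θ-approx Θ'-approx using (factor)

  regroup-right : compose A C D (compose A B C Θ Θ') Θ'' F x → compose A B D Θ (compose B C D Θ' Θ'') F x
  regroup-right (fF , H , fH , FH , HΘ''x) with factor H fF FH
  ... | G' , fG' , FG' , G'H = fF , G' , fG' , FG' , fG' , H , fH , G'H , HΘ''x

  regroup-left : compose A B D Θ (compose B C D Θ' Θ'') F x → compose A C D (compose A B C Θ Θ') Θ'' F x
  regroup-left (fF , G , fG , FG , _ , H , fH , GH , HΘ''x) =
    fF , H , fH , (λ p → fF , G , fG , FG , GH p) , HΘ''x

-- Left unit: id ∘ Θ = Θ.  (⊆) is AM2; (⊇) is interpolation in the domain.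
identity-left : ∀ (A B : FAugGCS) (Θ : FRel A B) → IsApproximable A B Θ →
                _≃_ {A} {B} (compose A A B (identity A) Θ) Θ
identity-left A B Θ Θ-approx F y = drop-identity , insert-identity
  where
  open Approximable Θ-approx using (transport; interpolate)

  drop-identity : compose A A B (identity A) Θ F y → Θ F y
  drop-identity (fF , G , fG , G⊆⟨F⟩ , Gy) = transport fG fF (λ p → proj₂ (G⊆⟨F⟩ p)) Gy

  insert-identity : Θ F y → compose A A B (identity A) Θ F y
  insert-identity Fy with interpolate Fy
  ... | K , fK , K⊆⟨F⟩ , Ky =
    dom-𝓕 Θ-approx Fy , K , fK , (λ p → dom-𝓕 Θ-approx Fy , K⊆⟨F⟩ p) , Ky

-- Right unit: Θ ∘ id = Θ.  (⊆) is AM1; (⊇) is the witness form of AM3.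
identity-right : ∀ (A B : FAugGCS) (Θ : FRel A B) → IsApproximable A B Θ →
                 _≃_ {A} {B} (compose A B B Θ (identity B)) Θ
identity-right A B Θ Θ-approx F y = drop-identity , insert-identity
  where
  open Approximable Θ-approx using (witness)

  drop-identity : compose A B B Θ (identity B) F y → Θ F y
  drop-identity (fF , G , fG , FG , _ , y∈⟨G⟩) = AM1 Θ-approx fF fG FG y∈⟨G⟩

  insert-identity : Θ F y → compose A B B Θ (identity B) F y
  insert-identity Fy with witness (y ∷ []) (dom-𝓕 Θ-approx Fy) (singleton-⊆ Fy)
  ... | G' , fG' , FG' , y∈⟨G'⟩ =
    dom-𝓕 Θ-approx Fy , G' , fG' , FG' , fG' , y∈⟨G'⟩ (here refl)

proposition4p7 : (∀ (A B C : FAugGCS) (Θ : FRel A B) (Θ' : FRel B C) →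
    IsApproximable A B Θ → IsApproximable B C Θ' → IsApproximable A C (compose A B C Θ Θ'))
    × (∀ (A : FAugGCS) → IsApproximable A A (identity A))
    × (∀ (A B C D : FAugGCS) (Θ : FRel A B) (Θ' : FRel B C) (Θ'' : FRel C D) →
    IsApproximable A B Θ → IsApproximable B C Θ' → IsApproximable C D Θ'' →
    _≃_ {A} {D} (compose A C D (compose A B C Θ Θ') Θ'') (compose A B D Θ (compose B C D Θ' Θ'')))
    × (∀ (A B : FAugGCS) (Θ : FRel A B) → IsApproximable A B Θ →
    _≃_ {A} {B} (compose A A B (identity A) Θ) Θ × _≃_ {A} {B} (compose A B B Θ (identity B)) Θ)
proposition4p7 =
    (λ A B C Θ Θ' Θ-approx Θ'-approx → Composite.composite-approximable A B C Θ-approx Θ'-approx)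
  , identity-approximable
  , composition-assoc
  , (λ A B Θ Θ-approx → identity-left A B Θ Θ-approx , identity-right A B Θ Θ-approx)
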